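{- Let $G$ and $H$ be similar distance-regular graphs. Then $W(G,H)>3$; that is, no first-order sentence with at most 3 distinct variables is true on one of $G,H$ and false on the other.
   Context: Graphs are finite, simple, undirected, loopless. For a connected graph $G$ and $u,v\in V(G)$, let $f^G_{i,j}(u,v)$ be the number of vertices at distance $i$ from $u$ and at distance $j$ from $v$. $G$ is distance-regular if $G$ is connected and $f^G_{i,j}(u,v)$ depends only on $i$, $j$ and $d(u,v)$; write it $f^G_{i,j}(d)$. Two distance-regular graphs $G,H$ are similar if for all $i,j,d$: $f^G_{i,j}(d)=0$ iff $f^H_{i,j}(d)=0$. First-order sentences about graphs use only adjacency $\sim$ and equality $=$; $W(G,H)$ is the minimum number of distinct variables in a sentence distinguishing $G$ and $H$. -}

module Defs where

open import Data.Nat using (ℕ; zero; suc; _+_; _<_)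
open import Data.Fin using (Fin; _≟_)
open import Data.Bool using (Bool; true; false; _∧_; _∨_; not; if_then_else_)
open import Data.List using (List; allFin; upTo; foldr)
open import Data.Bool.ListAction using (any; all)
open import Data.Product using (Σ; ∃; _×_; _,_)
open import Relation.Binary.PropositionalEquality using (_≡_; _≢_)
open import Relation.Nullary.Decidable using (⌊_⌋)
open import Function.Bundles using (_⇔_)

record Graph : Set where
  field
    n     : ℕ
    adj   : Fin n → Fin n → Bool
    sym   : ∀ u v → adj u v ≡ adj v u
    irrefl : ∀ u → adj u u ≡ false

open Graph public

Vtx : Graph → Set
Vtx G = Fin (n G)

walk : (G : Graph) → ℕ → Vtx G → Vtx G → Bool
walk G zero    u v = ⌊ u ≟ v ⌋
walk G (suc k) u v = any (λ w → adj G u w ∧ walk G k w v) (allFin (n G))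

isDist : (G : Graph) → Vtx G → Vtx G → ℕ → Bool
isDist G u v k = walk G k u v ∧ not (any (λ m → walk G m u v) (upTo k))

Connected : Graph → Set
Connected G = 0 < n G × (∀ u v → ∃ λ k → walk G k u v ≡ true)

count : {A : Set} → (A → Bool) → List A → ℕ
count p = foldr (λ a r → if p a then suc r else r) 0

f : (G : Graph) → ℕ → ℕ → Vtx G → Vtx G → ℕ
f G i j u v = count (λ w → isDist G u w i ∧ isDist G v w j) (allFin (n G))

DistanceRegular : Graph → Set
DistanceRegular G =
  Connected G ×
  (∀ i j d (u v u′ v′ : Vtx G) → isDist G u v d ≡ true → isDist G u′ v′ d ≡ true →
     f G i j u v ≡ f G i j u′ v′)

-- "f^G_{i,j}(d) ≠ 0": some (equivalently, by regularity, every) pair at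
-- distance d has f_{i,j} ≠ 0.  If d is not a distance occurring in G the
-- value f^G_{i,j}(d) is taken to be 0.
NonzeroAt : (G : Graph) → ℕ → ℕ → ℕ → Set
NonzeroAt G i j d = Σ (Vtx G) λ u → Σ (Vtx G) λ v → isDist G u v d ≡ true × f G i j u v ≢ 0

Similar : Graph → Graph → Set
Similar G H = ∀ i j d → NonzeroAt G i j d ⇔ NonzeroAt H i j d

data Formula (k : ℕ) : Set where
  ⊤ᶠ ⊥ᶠ      : Formula k
  _∼ᶠ_ _≐ᶠ_   : Fin k → Fin k → Formula k
  ¬ᶠ_        : Formula k → Formula k
  _∧ᶠ_ _∨ᶠ_ _⇒ᶠ_ _⇔ᶠ_ : Formula k → Formula k → Formula k
  ∃ᶠ ∀ᶠ      : Fin k → Formula k → Formula k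

data FreeIn {k : ℕ} (x : Fin k) : Formula k → Set where
  adjˡ : ∀ {y} → FreeIn x (x ∼ᶠ y)
  adjʳ : ∀ {y} → FreeIn x (y ∼ᶠ x)
  eqˡ  : ∀ {y} → FreeIn x (x ≐ᶠ y)
  eqʳ  : ∀ {y} → FreeIn x (y ≐ᶠ x)
  neg  : ∀ {φ} → FreeIn x φ → FreeIn x (¬ᶠ φ)
  andˡ : ∀ {φ ψ} → FreeIn x φ → FreeIn x (φ ∧ᶠ ψ)
  andʳ : ∀ {φ ψ} → FreeIn x ψ → FreeIn x (φ ∧ᶠ ψ)
  orˡ  : ∀ {φ ψ} → FreeIn x φ → FreeIn x (φ ∨ᶠ ψ)
  orʳ  : ∀ {φ ψ} → FreeIn x ψ → FreeIn x (φ ∨ᶠ ψ)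
  impˡ : ∀ {φ ψ} → FreeIn x φ → FreeIn x (φ ⇒ᶠ ψ)
  impʳ : ∀ {φ ψ} → FreeIn x ψ → FreeIn x (φ ⇒ᶠ ψ)
  iffˡ : ∀ {φ ψ} → FreeIn x φ → FreeIn x (φ ⇔ᶠ ψ)
  iffʳ : ∀ {φ ψ} → FreeIn x ψ → FreeIn x (φ ⇔ᶠ ψ)
  ex   : ∀ {y φ} → x ≢ y → FreeIn x φ → FreeIn x (∃ᶠ y φ)
  all′ : ∀ {y φ} → x ≢ y → FreeIn x φ → FreeIn x (∀ᶠ y φ)

Sentence : {k : ℕ} → Formula k → Set
Sentence {k} φ = ∀ (x : Fin k) → FreeIn x φ → Data.Empty.⊥
  where import Data.Empty

_[_↦_] : ∀ {k} {A : Set} → (Fin k → A) → Fin k → A → (Fin k → A)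
(ρ [ x ↦ a ]) y = if ⌊ y ≟ x ⌋ then a else ρ y

sat : ∀ {k} (G : Graph) → (Fin k → Vtx G) → Formula k → Bool
sat G ρ ⊤ᶠ = true
sat G ρ ⊥ᶠ = false
sat G ρ (x ∼ᶠ y) = adj G (ρ x) (ρ y)
sat G ρ (x ≐ᶠ y) = ⌊ ρ x ≟ ρ y ⌋
sat G ρ (¬ᶠ φ) = not (sat G ρ φ)
sat G ρ (φ ∧ᶠ ψ) = sat G ρ φ ∧ sat G ρ ψ
sat G ρ (φ ∨ᶠ ψ) = sat G ρ φ ∨ sat G ρ ψ
sat G ρ (φ ⇒ᶠ ψ) = not (sat G ρ φ) ∨ sat G ρ ψ
sat G ρ (φ ⇔ᶠ ψ) = ⌊ sat G ρ φ Data.Bool.≟ sat G ρ ψ ⌋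
  where import Data.Bool
sat G ρ (∃ᶠ x φ) = any (λ a → sat G (ρ [ x ↦ a ]) φ) (allFin (n G))
sat G ρ (∀ᶠ x φ) = all (λ a → sat G (ρ [ x ↦ a ]) φ) (allFin (n G))

-- φ distinguishes G and H (a sentence's truth value is independent of the
-- assignment, so we compare under arbitrary assignments)
Distinguishes : ∀ {k} → Formula k → Graph → Graph → Set
Distinguishes φ G H = Sentence φ × Σ (Fin _ → Vtx G) λ ρ → Σ (Fin _ → Vtx H) λ σ → sat G ρ φ ≢ sat H σ φ

-- This is the three-pebble Ehrenfeucht–Fraïssé game. Call assignments of the
-- variables in G and in H equivalent when corresponding pairs of vertices are at
-- the same distance; equivalent assignments satisfy the same atomic formulas,
-- since distance 0 is equality and distance 1 is adjacency. With three variables,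
-- moving one of them to a vertex a of G leaves two fixed vertices u, v, say at
-- distance d, and a is at distances i, j from them, so f^G_{i,j}(d) ≠ 0. By
-- similarity f^H_{i,j}(d) ≠ 0, and by distance-regularity of H this holds for the
-- corresponding pair u', v' of H, which is also at distance d: so some vertex b of
-- H is at distances i, j from u', v', and moving the variable to b keeps the
-- assignments equivalent. Induction on formulas then shows that equivalent
-- assignments give every 3-variable formula the same truth value. The truth value
-- of a sentence does not depend on the assignment, and two constant assignments
-- are equivalent.
module Submission where

open import Defs renaming (sym to adj-sym)
open import Relation.Nullary using (¬_; yes; no)
open import Relation.Nullary.Decidable using (⌊_⌋; toWitness; fromWitness)
open import Data.Nat using (ℕ; zero; suc; _<_)
open import Data.Nat.Properties using (<-cmp)
open import Data.Nat.Induction using (<-rec)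
open import Data.Fin using (Fin; _≟_) renaming (zero to 0F; suc to sucF)
open import Data.Bool using (Bool; true; false; _∧_; _∨_; not) renaming (_≟_ to _≟ᵇ_)
open import Data.Bool.Properties using (T-≡; ∧-identityʳ)
open import Data.List using ([]; _∷_; allFin; upTo)
open import Data.List.Properties using (map-cong)
open import Data.Bool.ListAction using (and; or; any; all)
open import Data.List.Membership.Propositional using (_∈_; find; lose)
open import Data.List.Membership.Propositional.Properties using (∈-allFin; ∈-upTo⁺; ∈-upTo⁻)
open import Data.List.Relation.Unary.Any using (here; there)
open import Data.List.Relation.Unary.Any.Properties using (any⁺; any⁻)
open import Data.Product using (Σ; ∃; _×_; _,_; proj₁; proj₂; map₁; map₂; uncurry)
open import Data.Sum using (_⊎_; inj₁; inj₂)
open import Data.Empty using (⊥-elim)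
open import Function using (_∘_)
open import Function.Bundles using (Equivalence)
open import Relation.Binary using (tri<; tri≈; tri>)
open import Relation.Binary.PropositionalEquality

open Equivalence using (to; from)

∧-elim : ∀ {a b} → a ∧ b ≡ true → a ≡ true × b ≡ true
∧-elim {true} {true} _ = refl , refl

∧-intro : ∀ {a b} → a ≡ true → b ≡ true → a ∧ b ≡ true
∧-intro refl refl = refl

≡-from-true⇔true : ∀ {a b} → (a ≡ true → b ≡ true) → (b ≡ true → a ≡ true) → a ≡ b
≡-from-true⇔true {false} {false} _ _ = refl
≡-from-true⇔true {false} {true}  _ b⇒a = b⇒a refl
≡-from-true⇔true {true}  {false} a⇒b _ = sym (a⇒b refl)
≡-from-true⇔true {true}  {true}  _ _ = refl

⌊≟⌋-true⇒≡ : ∀ {m} (u v : Fin m) → ⌊ u ≟ v ⌋ ≡ true → u ≡ v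
⌊≟⌋-true⇒≡ u v h = toWitness (from T-≡ h)

⌊≟⌋-refl : ∀ {m} (u : Fin m) → ⌊ u ≟ u ⌋ ≡ true
⌊≟⌋-refl u = to T-≡ (fromWitness refl)

any-witness : ∀ {A : Set} (p : A → Bool) xs → any p xs ≡ true → ∃ λ x → x ∈ xs × p x ≡ true
any-witness p xs h = map₂ (map₂ (to T-≡)) (find (any⁻ p xs (from T-≡ h)))

any-intro : ∀ {A : Set} (p : A → Bool) {x} xs → x ∈ xs → p x ≡ true → any p xs ≡ true
any-intro p xs x∈xs px = to T-≡ (any⁺ p (lose x∈xs (from T-≡ px)))

any-cong : ∀ {A : Set} {p q : A → Bool} → (∀ x → p x ≡ q x) → ∀ xs → any p xs ≡ any q xs
any-cong p≗q xs = cong or (map-cong p≗q xs)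

all-cong : ∀ {A : Set} {p q : A → Bool} → (∀ x → p x ≡ q x) → ∀ xs → all p xs ≡ all q xs
all-cong p≗q xs = cong and (map-cong p≗q xs)

all≡not-any-not : ∀ {A : Set} (p : A → Bool) xs → all p xs ≡ not (any (not ∘ p) xs)
all≡not-any-not p [] = refl
all≡not-any-not p (x ∷ xs) with p x
... | true  = all≡not-any-not p xs
... | false = refl

any-allFin-mono : ∀ {m n} (p : Fin m → Bool) (q : Fin n → Bool) → (∀ a → ∃ λ b → p a ≡ q b) →
  any p (allFin m) ≡ true → any q (allFin n) ≡ true
any-allFin-mono p q forth h with any-witness p (allFin _) h
... | a , _ , pa with forth a
... | b , pa≡qb = any-intro q (allFin _) (∈-allFin b) (trans (sym pa≡qb) pa)

any-allFin-≡ : ∀ {m n} (p : Fin m → Bool) (q : Fin n → Bool) →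
  (∀ a → ∃ λ b → p a ≡ q b) → (∀ b → ∃ λ a → p a ≡ q b) → any p (allFin m) ≡ any q (allFin n)
any-allFin-≡ p q forth back = ≡-from-true⇔true
  (any-allFin-mono p q forth) (any-allFin-mono q p (map₂ sym ∘ back))

all-allFin-≡ : ∀ {m n} (p : Fin m → Bool) (q : Fin n → Bool) →
  (∀ a → ∃ λ b → p a ≡ q b) → (∀ b → ∃ λ a → p a ≡ q b) → all p (allFin m) ≡ all q (allFin n)
all-allFin-≡ p q forth back = begin
  all p (allFin _)                ≡⟨ all≡not-any-not p (allFin _) ⟩
  not (any (not ∘ p) (allFin _))  ≡⟨ cong not (any-allFin-≡ (not ∘ p) (not ∘ q)
                                       (map₂ (cong not) ∘ forth) (map₂ (cong not) ∘ back)) ⟩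
  not (any (not ∘ q) (allFin _))  ≡⟨ sym (all≡not-any-not q (allFin _)) ⟩
  all q (allFin _)                ∎
  where open ≡-Reasoning

not-true : ∀ {b} → not b ≡ true → b ≢ true
not-true {false} _ ()

count-witness : ∀ {A : Set} (p : A → Bool) xs → count p xs ≢ 0 → ∃ λ x → x ∈ xs × p x ≡ true
count-witness p [] h = ⊥-elim (h refl)
count-witness p (x ∷ xs) h with p x in px
... | true  = x , here refl , px
... | false = map₂ (map₁ there) (count-witness p xs h)

count-intro : ∀ {A : Set} (p : A → Bool) {x} xs → x ∈ xs → p x ≡ true → count p xs ≢ 0
count-intro p (y ∷ xs) (here refl) px rewrite px = λ ()
count-intro p (y ∷ xs) (there x∈xs) px with p y
... | true  = λ ()
... | false = count-intro p xs x∈xs px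

module Distances (G : Graph) where

  walk-suc⁻ : ∀ k {u v} → walk G (suc k) u v ≡ true → ∃ λ w → adj G u w ≡ true × walk G k w v ≡ true
  walk-suc⁻ k h = map₂ (∧-elim ∘ proj₂) (any-witness _ (allFin _) h)

  walk-suc⁺ : ∀ k {u v} w → adj G u w ≡ true → walk G k w v ≡ true → walk G (suc k) u v ≡ true
  walk-suc⁺ k w uw wv = any-intro _ (allFin _) (∈-allFin w) (∧-intro uw wv)

  walk-snoc : ∀ k {u v} w → walk G k u w ≡ true → adj G w v ≡ true → walk G (suc k) u v ≡ true
  walk-snoc zero {u} w uw wv with ⌊≟⌋-true⇒≡ u w uw
  ... | refl = walk-suc⁺ 0 _ wv (⌊≟⌋-refl _)
  walk-snoc (suc k) w uw wv with walk-suc⁻ k uw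
  ... | w′ , uw′ , w′w = walk-suc⁺ (suc k) w′ uw′ (walk-snoc k w w′w wv)

  walk-sym : ∀ k {u v} → walk G k u v ≡ true → walk G k v u ≡ true
  walk-sym zero {u} {v} uv with ⌊≟⌋-true⇒≡ u v uv
  ... | refl = uv
  walk-sym (suc k) uv with walk-suc⁻ k uv
  ... | w , uw , wv = walk-snoc k w (walk-sym k wv) (trans (adj-sym G w _) uw)

  walk-comm : ∀ k u v → walk G k u v ≡ walk G k v u
  walk-comm k u v = ≡-from-true⇔true (walk-sym k) (walk-sym k)

  isDist-comm : ∀ u v k → isDist G u v k ≡ isDist G v u k
  isDist-comm u v k =
    cong₂ _∧_ (walk-comm k u v) (cong not (any-cong (λ m → walk-comm m u v) (upTo k)))

  isDist-minimal : ∀ {u v l m} → isDist G u v l ≡ true → m < l → walk G m u v ≢ true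
  isDist-minimal hl m<l w = not-true (proj₂ (∧-elim hl)) (any-intro _ (upTo _) (∈-upTo⁺ m<l) w)

  isDist-unique : ∀ {u v} i k → isDist G u v i ≡ true → isDist G u v k ≡ true → i ≡ k
  isDist-unique i k hi hk with <-cmp i k
  ... | tri< i<k _ _ = ⊥-elim (isDist-minimal hk i<k (proj₁ (∧-elim hi)))
  ... | tri≈ _ i≡k _ = i≡k
  ... | tri> _ _ k<i = ⊥-elim (isDist-minimal hi k<i (proj₁ (∧-elim hk)))

  isDist-from-walk : ∀ {u v} k → walk G k u v ≡ true → ∃ λ d → isDist G u v d ≡ true
  isDist-from-walk {u} {v} = <-rec _ shortest
    where
      shortest : ∀ k → (∀ {m} → m < k → walk G m u v ≡ true → ∃ λ d → isDist G u v d ≡ true) →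
        walk G k u v ≡ true → ∃ λ d → isDist G u v d ≡ true
      shortest k ih w with any (λ m → walk G m u v) (upTo k) in shorter
      ... | false = k , ∧-intro w (cong not shorter)
      ... | true with any-witness _ (upTo k) shorter
      ... | m , m∈ , wm = ih (∈-upTo⁻ m∈) wm

  isDist-exists : Connected G → ∀ u v → ∃ λ d → isDist G u v d ≡ true
  isDist-exists (_ , connected) u v = uncurry isDist-from-walk (connected u v)

  isDist-zero : ∀ u v → isDist G u v 0 ≡ ⌊ u ≟ v ⌋
  isDist-zero u v = ∧-identityʳ _

  isDist-self : ∀ u → isDist G u u 0 ≡ true
  isDist-self u = trans (isDist-zero u u) (⌊≟⌋-refl u)

  isDist-one : ∀ u v → isDist G u v 1 ≡ adj G u v
  isDist-one u v = ≡-from-true⇔true adjacent (λ uv → ∧-intro (walk-suc⁺ 0 v uv (⌊≟⌋-refl v)) (distinct uv))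
    where
      adjacent : isDist G u v 1 ≡ true → adj G u v ≡ true
      adjacent h with walk-suc⁻ 0 (proj₁ (∧-elim h))
      ... | w , uw , wv with ⌊≟⌋-true⇒≡ w v wv
      ... | refl = uw
      distinct : adj G u v ≡ true → not (⌊ u ≟ v ⌋ ∨ false) ≡ true
      distinct uv with u ≟ v
      ... | no _ = refl
      ... | yes refl with trans (sym uv) (irrefl G u)
      ...   | ()

open Distances

isDist-agree : ∀ {G H : Graph} {u v : Vtx G} {u′ v′ : Vtx H} d →
  isDist G u v d ≡ true → isDist H u′ v′ d ≡ true → ∀ k → isDist G u v k ≡ isDist H u′ v′ k
isDist-agree {G} {H} {u} {v} {u′} {v′} d hG hH k = ≡-from-true⇔true
  (λ h → subst (λ m → isDist H u′ v′ m ≡ true) (isDist-unique G d k hG h) hH)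
  (λ h → subst (λ m → isDist G u v m ≡ true) (isDist-unique H d k hH h) hG)

module _ {G H : Graph} (drH : DistanceRegular H)
         (G⇒H : ∀ i j d → NonzeroAt G i j d → NonzeroAt H i j d) where

  common-vertex-transfer : ∀ d i j {u v a : Vtx G} {u′ v′ : Vtx H} →
    isDist G u v d ≡ true → isDist H u′ v′ d ≡ true →
    isDist G u a i ≡ true → isDist G v a j ≡ true →
    ∃ λ b → isDist H u′ b i ≡ true × isDist H v′ b j ≡ true
  common-vertex-transfer d i j {u} {v} {a} {u′} {v′} uv u′v′ ua va
    with G⇒H i j d (u , v , uv , count-intro _ (allFin _) (∈-allFin a) (∧-intro ua va))
  ... | u₀ , v₀ , u₀v₀ , nonzero =
    map₂ (∧-elim ∘ proj₂)
      (count-witness _ (allFin _) (nonzero ∘ trans (proj₂ drH i j d u₀ v₀ u′ v′ u₀v₀ u′v′)))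

SameDistances : ∀ {k} (G H : Graph) → (Fin k → Vtx G) → (Fin k → Vtx H) → Set
SameDistances G H ρ σ = ∀ x y d → isDist G (ρ x) (ρ y) d ≡ isDist H (σ x) (σ y) d

SameDistances-sym : ∀ {k G H} {ρ : Fin k → Vtx G} {σ : Fin k → Vtx H} →
  SameDistances G H ρ σ → SameDistances H G σ ρ
SameDistances-sym same x y d = sym (same x y d)

SameDistances-const : ∀ {k G H} (a : Vtx G) (b : Vtx H) →
  SameDistances {k} G H (λ _ → a) (λ _ → b)
SameDistances-const {G = G} {H} a b _ _ = isDist-agree 0 (isDist-self G a) (isDist-self H b)

SameDistances-update : ∀ {k G H} {ρ : Fin k → Vtx G} {σ : Fin k → Vtx H} {x a b} →
  SameDistances G H ρ σ → (∀ y → y ≢ x → ∀ d → isDist G (ρ y) a d ≡ isDist H (σ y) b d) →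
  SameDistances G H (ρ [ x ↦ a ]) (σ [ x ↦ b ])
SameDistances-update {G = G} {H} {ρ} {σ} {x} {a} {b} same new y z d with y ≟ x | z ≟ x
... | yes refl | yes refl = isDist-agree 0 (isDist-self G a) (isDist-self H b) d
... | yes refl | no z≢x   = trans (isDist-comm G a (ρ z) d) (trans (new z z≢x d) (isDist-comm H (σ z) b d))
... | no y≢x   | yes refl = new y y≢x d
... | no _     | no _     = same y z d

ForthProperty : ℕ → Graph → Graph → Set
ForthProperty k G H = ∀ (ρ : Fin k → Vtx G) σ → SameDistances G H ρ σ →
  ∀ x a → ∃ λ b → SameDistances G H (ρ [ x ↦ a ]) (σ [ x ↦ b ])

other-two : (x : Fin 3) → Σ (Fin 3) λ y → Σ (Fin 3) λ z → ∀ w → w ≢ x → w ≡ y ⊎ w ≡ z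
other-two 0F = sucF 0F , sucF (sucF 0F) , λ
  { 0F w≢x → ⊥-elim (w≢x refl) ; (sucF 0F) _ → inj₁ refl ; (sucF (sucF 0F)) _ → inj₂ refl }
other-two (sucF 0F) = 0F , sucF (sucF 0F) , λ
  { 0F _ → inj₁ refl ; (sucF 0F) w≢x → ⊥-elim (w≢x refl) ; (sucF (sucF 0F)) _ → inj₂ refl }
other-two (sucF (sucF 0F)) = 0F , sucF 0F , λ
  { 0F _ → inj₁ refl ; (sucF 0F) _ → inj₂ refl ; (sucF (sucF 0F)) w≢x → ⊥-elim (w≢x refl) }

forth-three : ∀ {G H} → Connected G → DistanceRegular H →
  (∀ i j d → NonzeroAt G i j d → NonzeroAt H i j d) → ForthProperty 3 G H
forth-three {G} {H} cG drH G⇒H ρ σ same x a with other-two x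
... | y , z , y-or-z
  with isDist-exists G cG (ρ y) (ρ z) | isDist-exists G cG (ρ y) a | isDist-exists G cG (ρ z) a
... | d , yz | i , ya | j , za
  with common-vertex-transfer drH G⇒H d i j yz (trans (sym (same y z d)) yz) ya za
... | b , yb , zb = b , SameDistances-update same agree
  where
    agree : ∀ w → w ≢ x → ∀ e → isDist G (ρ w) a e ≡ isDist H (σ w) b e
    agree w w≢x with y-or-z w w≢x
    ... | inj₁ refl = isDist-agree i ya yb
    ... | inj₂ refl = isDist-agree j za zb

module _ {k} {G H : Graph} (forth : ForthProperty k G H) (back : ForthProperty k H G) where

  sat-invariant : ∀ {ρ σ} → SameDistances G H ρ σ → (φ : Formula k) → sat G ρ φ ≡ sat H σ φ

  forth-answer : ∀ {ρ σ} → SameDistances G H ρ σ → ∀ x φ a →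
    ∃ λ b → sat G (ρ [ x ↦ a ]) φ ≡ sat H (σ [ x ↦ b ]) φ
  forth-answer same x φ a = map₂ (λ same′ → sat-invariant same′ φ) (forth _ _ same x a)

  back-answer : ∀ {ρ σ} → SameDistances G H ρ σ → ∀ x φ b →
    ∃ λ a → sat G (ρ [ x ↦ a ]) φ ≡ sat H (σ [ x ↦ b ]) φ
  back-answer same x φ b =
    map₂ (λ same′ → sat-invariant (SameDistances-sym same′) φ) (back _ _ (SameDistances-sym same) x b)

  sat-invariant same ⊤ᶠ = refl
  sat-invariant same ⊥ᶠ = refl
  sat-invariant {ρ} {σ} same (x ∼ᶠ y) = begin
    adj G (ρ x) (ρ y)        ≡⟨ isDist-one G (ρ x) (ρ y) ⟨
    isDist G (ρ x) (ρ y) 1   ≡⟨ same x y 1 ⟩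
    isDist H (σ x) (σ y) 1   ≡⟨ isDist-one H (σ x) (σ y) ⟩
    adj H (σ x) (σ y)        ∎
    where open ≡-Reasoning
  sat-invariant {ρ} {σ} same (x ≐ᶠ y) = begin
    ⌊ ρ x ≟ ρ y ⌋            ≡⟨ isDist-zero G (ρ x) (ρ y) ⟨
    isDist G (ρ x) (ρ y) 0   ≡⟨ same x y 0 ⟩
    isDist H (σ x) (σ y) 0   ≡⟨ isDist-zero H (σ x) (σ y) ⟩
    ⌊ σ x ≟ σ y ⌋            ∎
    where open ≡-Reasoning
  sat-invariant same (¬ᶠ φ)   = cong not (sat-invariant same φ)
  sat-invariant same (φ ∧ᶠ ψ) = cong₂ _∧_ (sat-invariant same φ) (sat-invariant same ψ)
  sat-invariant same (φ ∨ᶠ ψ) = cong₂ _∨_ (sat-invariant same φ) (sat-invariant same ψ)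
  sat-invariant same (φ ⇒ᶠ ψ) = cong₂ (λ p q → not p ∨ q) (sat-invariant same φ) (sat-invariant same ψ)
  sat-invariant same (φ ⇔ᶠ ψ) = cong₂ (λ p q → ⌊ p ≟ᵇ q ⌋) (sat-invariant same φ) (sat-invariant same ψ)
  sat-invariant same (∃ᶠ x φ) = any-allFin-≡ _ _ (forth-answer same x φ) (back-answer same x φ)
  sat-invariant same (∀ᶠ x φ) = all-allFin-≡ _ _ (forth-answer same x φ) (back-answer same x φ)

update-cong : ∀ {k} {A : Set} (ρ ρ′ : Fin k → A) y a x →
  (x ≢ y → ρ x ≡ ρ′ x) → (ρ [ y ↦ a ]) x ≡ (ρ′ [ y ↦ a ]) x
update-cong ρ ρ′ y a x agree with x ≟ y
... | yes _  = refl
... | no x≢y = agree x≢y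

sat-cong-free : ∀ (G : Graph) {k} {ρ ρ′ : Fin k → Vtx G} (φ : Formula k) →
  (∀ x → FreeIn x φ → ρ x ≡ ρ′ x) → sat G ρ φ ≡ sat G ρ′ φ
sat-cong-free G ⊤ᶠ agree = refl
sat-cong-free G ⊥ᶠ agree = refl
sat-cong-free G (x ∼ᶠ y) agree = cong₂ (adj G) (agree x adjˡ) (agree y adjʳ)
sat-cong-free G (x ≐ᶠ y) agree = cong₂ (λ u v → ⌊ u ≟ v ⌋) (agree x eqˡ) (agree y eqʳ)
sat-cong-free G (¬ᶠ φ) agree = cong not (sat-cong-free G φ (λ x → agree x ∘ neg))
sat-cong-free G (φ ∧ᶠ ψ) agree =
  cong₂ _∧_ (sat-cong-free G φ (λ x → agree x ∘ andˡ)) (sat-cong-free G ψ (λ x → agree x ∘ andʳ))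
sat-cong-free G (φ ∨ᶠ ψ) agree =
  cong₂ _∨_ (sat-cong-free G φ (λ x → agree x ∘ orˡ)) (sat-cong-free G ψ (λ x → agree x ∘ orʳ))
sat-cong-free G (φ ⇒ᶠ ψ) agree = cong₂ (λ p q → not p ∨ q)
  (sat-cong-free G φ (λ x → agree x ∘ impˡ)) (sat-cong-free G ψ (λ x → agree x ∘ impʳ))
sat-cong-free G (φ ⇔ᶠ ψ) agree = cong₂ (λ p q → ⌊ p ≟ᵇ q ⌋)
  (sat-cong-free G φ (λ x → agree x ∘ iffˡ)) (sat-cong-free G ψ (λ x → agree x ∘ iffʳ))
sat-cong-free G {ρ = ρ} {ρ′} (∃ᶠ y φ) agree = any-cong (λ a → sat-cong-free G φ
  (λ x x∈φ → update-cong ρ ρ′ y a x (λ x≢y → agree x (ex x≢y x∈φ)))) (allFin _)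
sat-cong-free G {ρ = ρ} {ρ′} (∀ᶠ y φ) agree = all-cong (λ a → sat-cong-free G φ
  (λ x x∈φ → update-cong ρ ρ′ y a x (λ x≢y → agree x (all′ x≢y x∈φ)))) (allFin _)

sentence-sat-independent : ∀ (G : Graph) {k} {φ : Formula k} → Sentence φ →
  ∀ ρ ρ′ → sat G ρ φ ≡ sat G ρ′ φ
sentence-sat-independent G {φ = φ} closed ρ ρ′ = sat-cong-free G φ (λ x → ⊥-elim ∘ closed x)

lemma4p9 : (G H : Graph) → DistanceRegular G → DistanceRegular H → Similar G H →
    (φ : Formula 3) → ¬ Distinguishes φ G H
lemma4p9 G H drG drH similar φ (closed , ρ , σ , differ) = differ (begin
  sat G ρ φ             ≡⟨ sentence-sat-independent G closed ρ (λ _ → a) ⟩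
  sat G (λ _ → a) φ     ≡⟨ sat-invariant G⇒H H⇒G (SameDistances-const a b) φ ⟩
  sat H (λ _ → b) φ     ≡⟨ sentence-sat-independent H closed (λ _ → b) σ ⟩
  sat H σ φ             ∎)
  where
    open ≡-Reasoning
    a : Vtx G
    a = ρ 0F
    b : Vtx H
    b = σ 0F
    G⇒H : ForthProperty 3 G H
    G⇒H = forth-three (proj₁ drG) drH (λ i j d → to (similar i j d))
    H⇒G : ForthProperty 3 H G
    H⇒G = forth-three (proj₁ drH) drG (λ i j d → from (similar i j d))
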